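{- Let $n\ge 2$. Then \[ \sum_{k=1}^{n}[k]_q\,q^{k-1}\,\frac{[k]_q\,[k-1]_q}{1+q}\;=\;q^{ -1}\sum_{(a,b,c,d)\in B,\ c<d} q^{(a-1)+(b-2)+(c-1)+(d-1)}, \] where the sum on the right runs over the location labels $(a,b,c,d)$ of the unit cubes of block $B$ with $c<d$.
   Context: $[k]_q=1+q+\cdots+q^{k-1}$ for non-negative integers $k$ (so $[0]_q=0$). For fixed $n\ge 2$, block $B$ is the union of the unit cubes $\{(x,y,z,w): a-1\le x\le a,\ b-1\le y\le b,\ c-1\le z\le c,\ d-1\le w\le d\}$ whose location labels $(a,b,c,d)$ lie in $\{(x,y,z,w)\in\mathbb{Z}^4: 1\le i\le n,\ y=i+1,\ x,z,w\in\{1,\dots,i\}\}$. -}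

module Defs where

open import Data.Nat as ℕ using (ℕ; zero; suc; _∸_; _<ᵇ_)
open import Data.Bool using (Bool; if_then_else_)
open import Data.List using (List; []; _∷_; map; concatMap; filterᵇ; foldr; upTo)
open import Data.Product using (_×_; _,_)
open import Data.Rational using (ℚ; 0ℚ; 1ℚ; _+_; _*_)

_^ℚ_ : ℚ → ℕ → ℚ
q ^ℚ zero  = 1ℚ
q ^ℚ suc m = q * (q ^ℚ m)

[_]⟨_⟩ : ℕ → ℚ → ℚ
[ zero ]⟨ q ⟩  = 0ℚ
[ suc k ]⟨ q ⟩ = 1ℚ + q * [ k ]⟨ q ⟩

sumℚ : List ℚ → ℚ
sumℚ = foldr _+_ 0ℚ

range1 : ℕ → List ℕ
range1 m = map suc (upTo m)

Label : Set
Label = ℕ × ℕ × ℕ × ℕ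

-- location labels of the unit cubes of block B:
-- {(x,y,z,w) : 1 ≤ i ≤ n, y = i+1, x,z,w ∈ {1,…,i}}
blockB : ℕ → List Label
blockB n = concatMap (λ i →
             concatMap (λ x →
               concatMap (λ z →
                 map (λ w → (x , suc i , z , w)) (range1 i))
               (range1 i))
             (range1 i))
           (range1 n)

blockB-c<d : ℕ → List Label
blockB-c<d n = filterᵇ (λ { (a , b , c , d) → c <ᵇ d }) (blockB n)

weight : ℚ → Label → ℚ
weight q (a , b , c , d) = q ^ℚ ((a ∸ 1) ℕ.+ (b ∸ 2) ℕ.+ (c ∸ 1) ℕ.+ (d ∸ 1))

{-# OPTIONS --safe #-}
-- Group the cubes of B into layers i = b − 1.  In layer i the weight of (x, i+1, z, w)
-- factors as q^(x−1) q^(i−1) · q^(z−1) q^(w−1), so the layer contributes [i] q^(i−1) e₂(i)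
-- with e₂(i) = Σ_{1≤z<w≤i} q^(z−1) q^(w−1).  Adding the column w = i+1 gives
-- e₂(i+1) = e₂(i) + [i] q^i, and as [i+1] − [i−1] = (1+q) q^(i−1), induction on i yields
-- (1+q) e₂(i) = q [i] [i−1].  The factor q cancels the q⁻¹ of the right-hand side.
module Submission where

open import Defs
open import Data.Nat using (ℕ; _≤_; _∸_)
open import Data.List using (map)
open import Data.Rational using (ℚ; NonZero; 1ℚ; _+_; _*_; _÷_; 1/_)
open import Relation.Binary.PropositionalEquality using (_≡_)

open import Data.Bool using (Bool; true; false; if_then_else_; T)
open import Data.List using (List; []; _∷_; _++_; concatMap; filterᵇ; upTo)
open import Data.Product using (_,_)
open import Data.List.Properties using (map-++; map-∘; map-cong; upTo-∷ʳ)
open import Data.Nat as ℕ using (zero; suc; s≤s; _<ᵇ_)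
open import Data.Nat.Properties using (≤-refl; m≤n⇒m≤1+n; ≤⇒≯; <ᵇ⇒<; <⇒<ᵇ)
open import Data.Rational using (0ℚ)
open import Data.Rational.Properties
  using (+-assoc; +-identityˡ; +-identityʳ; *-assoc; *-identityˡ; *-zeroʳ; *-distribˡ-+; *-comm; *-inverseˡ)
open import Data.Rational.Solver using (module +-*-Solver)
open import Data.Empty using (⊥-elim)
open import Relation.Nullary using (¬_)
open import Relation.Binary.PropositionalEquality using (refl; sym; trans; cong; cong₂; module ≡-Reasoning)

open +-*-Solver using (solve; _:=_; _:+_; _:*_; con)
open ≡-Reasoning

private
  variable
    A B : Set

sumℚ-++ : (xs ys : List ℚ) → sumℚ (xs ++ ys) ≡ sumℚ xs + sumℚ ys
sumℚ-++ []       ys = sym (+-identityˡ (sumℚ ys))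
sumℚ-++ (x ∷ xs) ys = trans (cong (x +_) (sumℚ-++ xs ys)) (sym (+-assoc x (sumℚ xs) (sumℚ ys)))

sumℚ-map-0 : (xs : List A) → sumℚ (map (λ _ → 0ℚ) xs) ≡ 0ℚ
sumℚ-map-0 []       = refl
sumℚ-map-0 (_ ∷ xs) = trans (+-identityˡ _) (sumℚ-map-0 xs)

sumℚ-map-+ : (f g : A → ℚ) (xs : List A) →
  sumℚ (map (λ x → f x + g x) xs) ≡ sumℚ (map f xs) + sumℚ (map g xs)
sumℚ-map-+ f g []       = sym (+-identityʳ 0ℚ)
sumℚ-map-+ f g (x ∷ xs) = begin
  (f x + g x) + sumℚ (map (λ x → f x + g x) xs)         ≡⟨ cong ((f x + g x) +_) (sumℚ-map-+ f g xs) ⟩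
  (f x + g x) + (sumℚ (map f xs) + sumℚ (map g xs))     ≡⟨ solve 4 (λ a b c d → (a :+ b) :+ (c :+ d) := (a :+ c) :+ (b :+ d))
                                                              refl (f x) (g x) (sumℚ (map f xs)) (sumℚ (map g xs)) ⟩
  (f x + sumℚ (map f xs)) + (g x + sumℚ (map g xs))     ∎

*-distribˡ-sumℚ-map : (c : ℚ) (f : A → ℚ) (xs : List A) →
  c * sumℚ (map f xs) ≡ sumℚ (map (λ x → c * f x) xs)
*-distribˡ-sumℚ-map c f []       = *-zeroʳ c
*-distribˡ-sumℚ-map c f (x ∷ xs) =
  trans (*-distribˡ-+ c (f x) _) (cong (c * f x +_) (*-distribˡ-sumℚ-map c f xs))

*-distribʳ-sumℚ-map : (c : ℚ) (f : A → ℚ) (xs : List A) →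
  sumℚ (map f xs) * c ≡ sumℚ (map (λ x → f x * c) xs)
*-distribʳ-sumℚ-map c f xs = begin
  sumℚ (map f xs) * c                 ≡⟨ *-comm _ c ⟩
  c * sumℚ (map f xs)                 ≡⟨ *-distribˡ-sumℚ-map c f xs ⟩
  sumℚ (map (λ x → c * f x) xs)       ≡⟨ cong sumℚ (map-cong (λ x → *-comm c (f x)) xs) ⟩
  sumℚ (map (λ x → f x * c) xs)       ∎

sumℚ-map-filterᵇ : (p : A → Bool) (f : A → ℚ) (xs : List A) →
  sumℚ (map f (filterᵇ p xs)) ≡ sumℚ (map (λ x → if p x then f x else 0ℚ) xs)
sumℚ-map-filterᵇ p f []       = refl
sumℚ-map-filterᵇ p f (x ∷ xs) with p x
... | true  = cong (f x +_) (sumℚ-map-filterᵇ p f xs)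
... | false = trans (sumℚ-map-filterᵇ p f xs) (sym (+-identityˡ _))

sumℚ-map-concatMap : (f : B → ℚ) (g : A → List B) (xs : List A) →
  sumℚ (map f (concatMap g xs)) ≡ sumℚ (map (λ x → sumℚ (map f (g x))) xs)
sumℚ-map-concatMap f g []       = refl
sumℚ-map-concatMap f g (x ∷ xs) = begin
  sumℚ (map f (g x ++ concatMap g xs))                 ≡⟨ cong sumℚ (map-++ f (g x) (concatMap g xs)) ⟩
  sumℚ (map f (g x) ++ map f (concatMap g xs))         ≡⟨ sumℚ-++ (map f (g x)) _ ⟩
  sumℚ (map f (g x)) + sumℚ (map f (concatMap g xs))   ≡⟨ cong (sumℚ (map f (g x)) +_) (sumℚ-map-concatMap f g xs) ⟩
  sumℚ (map f (g x)) + sumℚ (map (λ x → sumℚ (map f (g x))) xs) ∎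

∑ : ℕ → (ℕ → ℚ) → ℚ
∑ n f = sumℚ (map f (range1 n))

-- k runs over 1, …, n.
infixr 9 ∑
syntax ∑ n (λ k → e) = ∑[ k ≤ n ] e

∑-suc : ∀ n (f : ℕ → ℚ) → ∑ (suc n) f ≡ ∑ n f + f (suc n)
∑-suc n f = begin
  sumℚ (map f (map suc (upTo (suc n))))        ≡⟨ cong (λ ks → sumℚ (map f (map suc ks))) (sym (upTo-∷ʳ n)) ⟩
  sumℚ (map f (map suc (upTo n ++ n ∷ [])))    ≡⟨ cong (λ ks → sumℚ (map f ks)) (map-++ suc (upTo n) _) ⟩
  sumℚ (map f (range1 n ++ suc n ∷ []))        ≡⟨ cong sumℚ (map-++ f (range1 n) _) ⟩
  sumℚ (map f (range1 n) ++ f (suc n) ∷ [])    ≡⟨ sumℚ-++ (map f (range1 n)) _ ⟩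
  ∑ n f + (f (suc n) + 0ℚ)                     ≡⟨ cong (∑ n f +_) (+-identityʳ _) ⟩
  ∑ n f + f (suc n)                            ∎

∑-cong : ∀ n {f g : ℕ → ℚ} → (∀ k → f k ≡ g k) → ∑ n f ≡ ∑ n g
∑-cong n f≗g = cong sumℚ (map-cong f≗g (range1 n))

∑-cong-≤ : ∀ n {f g : ℕ → ℚ} → (∀ {k} → k ≤ n → f k ≡ g k) → ∑ n f ≡ ∑ n g
∑-cong-≤ zero    _   = refl
∑-cong-≤ (suc n) {f} {g} f≗g = begin
  ∑ (suc n) f          ≡⟨ ∑-suc n f ⟩
  ∑ n f + f (suc n)    ≡⟨ cong₂ _+_ (∑-cong-≤ n (λ k≤n → f≗g (m≤n⇒m≤1+n k≤n))) (f≗g ≤-refl) ⟩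
  ∑ n g + g (suc n)    ≡⟨ sym (∑-suc n g) ⟩
  ∑ (suc n) g          ∎

^ℚ-distribˡ-+-* : ∀ q m n → q ^ℚ (m ℕ.+ n) ≡ q ^ℚ m * q ^ℚ n
^ℚ-distribˡ-+-* q zero    n = sym (*-identityˡ _)
^ℚ-distribˡ-+-* q (suc m) n = trans (cong (q *_) (^ℚ-distribˡ-+-* q m n)) (sym (*-assoc q _ _))

[1+k]≡[k]+q^k : ∀ q k → [ suc k ]⟨ q ⟩ ≡ [ k ]⟨ q ⟩ + q ^ℚ k
[1+k]≡[k]+q^k q zero    = solve 1 (λ q → con 1ℚ :+ q :* con 0ℚ := con 0ℚ :+ con 1ℚ) refl q
[1+k]≡[k]+q^k q (suc k) = begin
  1ℚ + q * [ suc k ]⟨ q ⟩                  ≡⟨ cong (λ t → 1ℚ + q * t) ([1+k]≡[k]+q^k q k) ⟩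
  1ℚ + q * ([ k ]⟨ q ⟩ + q ^ℚ k)           ≡⟨ solve 3 (λ q a p → con 1ℚ :+ q :* (a :+ p) := (con 1ℚ :+ q :* a) :+ q :* p)
                                                  refl q [ k ]⟨ q ⟩ (q ^ℚ k) ⟩
  (1ℚ + q * [ k ]⟨ q ⟩) + q * q ^ℚ k       ∎

geometric-sum : ∀ q n → ∑[ k ≤ n ] q ^ℚ (k ∸ 1) ≡ [ n ]⟨ q ⟩
geometric-sum q zero    = refl
geometric-sum q (suc n) = begin
  ∑[ k ≤ suc n ] q ^ℚ (k ∸ 1)          ≡⟨ ∑-suc n _ ⟩
  ∑[ k ≤ n ] q ^ℚ (k ∸ 1) + q ^ℚ n     ≡⟨ cong (_+ q ^ℚ n) (geometric-sum q n) ⟩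
  [ n ]⟨ q ⟩ + q ^ℚ n                  ≡⟨ sym ([1+k]≡[k]+q^k q n) ⟩
  [ suc n ]⟨ q ⟩                       ∎

if-true : ∀ {b} {x y : A} → T b → (if b then x else y) ≡ x
if-true {b = true} _ = refl

if-false : ∀ {b} {x y : A} → ¬ T b → (if b then x else y) ≡ y
if-false {b = false} _  = refl
if-false {b = true}  ¬t = ⊥-elim (¬t _)

∑< : ℕ → (ℕ → ℕ → ℚ) → ℚ
∑< n f = ∑[ z ≤ n ] ∑[ w ≤ n ] (if z <ᵇ w then f z w else 0ℚ)

∑<-cong : ∀ n {f g : ℕ → ℕ → ℚ} → (∀ z w → f z w ≡ g z w) → ∑< n f ≡ ∑< n g
∑<-cong n f≗g = ∑-cong n (λ z → ∑-cong n (λ w → cong (if z <ᵇ w then_else 0ℚ) (f≗g z w)))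

*-distribˡ-∑< : ∀ n c (f : ℕ → ℕ → ℚ) → c * ∑< n f ≡ ∑< n (λ z w → c * f z w)
*-distribˡ-∑< n c f = trans (*-distribˡ-sumℚ-map c _ (range1 n))
  (∑-cong n (λ z → trans (*-distribˡ-sumℚ-map c _ (range1 n)) (∑-cong n (λ w → *-if (z <ᵇ w)))))
  where
  *-if : ∀ b {x} → c * (if b then x else 0ℚ) ≡ (if b then c * x else 0ℚ)
  *-if true  = refl
  *-if false = *-zeroʳ c

∑<-suc : ∀ n f → ∑< (suc n) f ≡ ∑< n f + ∑[ z ≤ n ] f z (suc n)
∑<-suc n f = begin
  ∑< (suc n) f
    ≡⟨ ∑-suc n _ ⟩
  ∑[ z ≤ n ] ∑[ w ≤ suc n ] E z w + ∑[ w ≤ suc n ] E (suc n) w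
    ≡⟨ cong₂ _+_ (∑-cong-≤ n last-column) (∑-cong-≤ (suc n) last-row) ⟩
  ∑[ z ≤ n ] (∑[ w ≤ n ] E z w + f z (suc n)) + ∑[ w ≤ suc n ] 0ℚ
    ≡⟨ cong₂ _+_ (sumℚ-map-+ _ _ (range1 n)) (sumℚ-map-0 (range1 (suc n))) ⟩
  (∑< n f + ∑[ z ≤ n ] f z (suc n)) + 0ℚ
    ≡⟨ +-identityʳ _ ⟩
  ∑< n f + ∑[ z ≤ n ] f z (suc n)
    ∎
  where
  E : ℕ → ℕ → ℚ
  E z w = if z <ᵇ w then f z w else 0ℚ

  last-column : ∀ {z} → z ≤ n → ∑[ w ≤ suc n ] E z w ≡ ∑[ w ≤ n ] E z w + f z (suc n)
  last-column {z} z≤n′ = trans (∑-suc n (E z)) (cong (∑ n (E z) +_) (if-true (<⇒<ᵇ (s≤s z≤n′))))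

  last-row : ∀ {w} → w ≤ suc n → E (suc n) w ≡ 0ℚ
  last-row w≤1+n = if-false (λ t → ≤⇒≯ w≤1+n (<ᵇ⇒< _ _ t))

e₂ : ℚ → ℕ → ℚ
e₂ q n = ∑< n (λ z w → q ^ℚ (z ∸ 1) * q ^ℚ (w ∸ 1))

e₂-suc : ∀ q n → e₂ q (suc n) ≡ e₂ q n + [ n ]⟨ q ⟩ * q ^ℚ n
e₂-suc q n = begin
  e₂ q (suc n)                                           ≡⟨ ∑<-suc n _ ⟩
  e₂ q n + ∑[ z ≤ n ] (q ^ℚ (z ∸ 1) * q ^ℚ n)            ≡⟨ cong (e₂ q n +_) (sym (*-distribʳ-sumℚ-map (q ^ℚ n) _ (range1 n))) ⟩
  e₂ q n + (∑[ z ≤ n ] q ^ℚ (z ∸ 1)) * q ^ℚ n            ≡⟨ cong (λ t → e₂ q n + t * q ^ℚ n) (geometric-sum q n) ⟩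
  e₂ q n + [ n ]⟨ q ⟩ * q ^ℚ n                           ∎

-- q [n] ([n+1] − [n−1]) = (1 + q) [n] q^n, rearranged so that no subtraction occurs.
q[n][n-1]-suc : ∀ q n →
  q * ([ n ]⟨ q ⟩ * [ n ∸ 1 ]⟨ q ⟩) + (1ℚ + q) * ([ n ]⟨ q ⟩ * q ^ℚ n) ≡ q * ([ suc n ]⟨ q ⟩ * [ n ]⟨ q ⟩)
q[n][n-1]-suc q zero =
  solve 1 (λ q → q :* (con 0ℚ :* con 0ℚ) :+ (con 1ℚ :+ q) :* (con 0ℚ :* con 1ℚ) := q :* ((con 1ℚ :+ q :* con 0ℚ) :* con 0ℚ)) refl q
q[n][n-1]-suc q (suc m) = begin
  q * (b * a) + (1ℚ + q) * (b * (q * p))       ≡⟨ cong (λ t → q * (t * a) + (1ℚ + q) * (t * (q * p))) b≡a+p ⟩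
  q * ((a + p) * a) + (1ℚ + q) * ((a + p) * (q * p))
    ≡⟨ solve 3 (λ q a p → q :* ((a :+ p) :* a) :+ (con 1ℚ :+ q) :* ((a :+ p) :* (q :* p))
                        := q :* (((a :+ p) :+ q :* p) :* (a :+ p))) refl q a p ⟩
  q * (((a + p) + q * p) * (a + p))            ≡⟨ cong₂ (λ s t → q * (s * t)) (sym c≡a+p+qp) (sym b≡a+p) ⟩
  q * (c * b)                                  ∎
  where
  a b c p : ℚ
  a = [ m ]⟨ q ⟩
  b = [ suc m ]⟨ q ⟩
  c = [ suc (suc m) ]⟨ q ⟩
  p = q ^ℚ m
  b≡a+p : b ≡ a + p
  b≡a+p = [1+k]≡[k]+q^k q m
  c≡a+p+qp : c ≡ (a + p) + q * p
  c≡a+p+qp = trans ([1+k]≡[k]+q^k q (suc m)) (cong (_+ q * p) b≡a+p)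

[1+q]*e₂≡q*[n]*[n-1] : ∀ q n → (1ℚ + q) * e₂ q n ≡ q * ([ n ]⟨ q ⟩ * [ n ∸ 1 ]⟨ q ⟩)
[1+q]*e₂≡q*[n]*[n-1] q zero    = solve 1 (λ q → (con 1ℚ :+ q) :* con 0ℚ := q :* (con 0ℚ :* con 0ℚ)) refl q
[1+q]*e₂≡q*[n]*[n-1] q (suc n) = begin
  (1ℚ + q) * e₂ q (suc n)                                            ≡⟨ cong ((1ℚ + q) *_) (e₂-suc q n) ⟩
  (1ℚ + q) * (e₂ q n + [ n ]⟨ q ⟩ * q ^ℚ n)                           ≡⟨ *-distribˡ-+ (1ℚ + q) (e₂ q n) _ ⟩
  (1ℚ + q) * e₂ q n + (1ℚ + q) * ([ n ]⟨ q ⟩ * q ^ℚ n)                ≡⟨ cong (_+ (1ℚ + q) * ([ n ]⟨ q ⟩ * q ^ℚ n)) ([1+q]*e₂≡q*[n]*[n-1] q n) ⟩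
  q * ([ n ]⟨ q ⟩ * [ n ∸ 1 ]⟨ q ⟩) + (1ℚ + q) * ([ n ]⟨ q ⟩ * q ^ℚ n) ≡⟨ q[n][n-1]-suc q n ⟩
  q * ([ suc n ]⟨ q ⟩ * [ n ]⟨ q ⟩)                                   ∎

p*x≡y⇒x≡y÷p : ∀ p .{{_ : NonZero p}} {x y} → p * x ≡ y → x ≡ y ÷ p
p*x≡y⇒x≡y÷p p {x} refl = begin
  x                      ≡⟨ sym (*-identityˡ x) ⟩
  1ℚ * x                 ≡⟨ cong (_* x) (sym (*-inverseˡ p)) ⟩
  (1/ p * p) * x         ≡⟨ solve 3 (λ u p x → (u :* p) :* x := (p :* x) :* u) refl (1/ p) p x ⟩
  (p * x) * 1/ p         ∎

e₂≡q*[n]*[n-1]÷[1+q] : ∀ q .{{_ : NonZero (1ℚ + q)}} n →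
  e₂ q n ≡ q * ([ n ]⟨ q ⟩ * [ n ∸ 1 ]⟨ q ⟩ ÷ (1ℚ + q))
e₂≡q*[n]*[n-1]÷[1+q] q n =
  trans (p*x≡y⇒x≡y÷p (1ℚ + q) ([1+q]*e₂≡q*[n]*[n-1] q n)) (*-assoc q _ _)

weight-split : ∀ q i x z w →
  weight q (x , suc i , z , w) ≡ (q ^ℚ (x ∸ 1) * q ^ℚ (i ∸ 1)) * (q ^ℚ (z ∸ 1) * q ^ℚ (w ∸ 1))
weight-split q i x z w = begin
  q ^ℚ (x′ ℕ.+ i′ ℕ.+ z′ ℕ.+ w′)               ≡⟨ ^ℚ-distribˡ-+-* q (x′ ℕ.+ i′ ℕ.+ z′) w′ ⟩
  q ^ℚ (x′ ℕ.+ i′ ℕ.+ z′) * q ^ℚ w′            ≡⟨ cong (_* q ^ℚ w′) (^ℚ-distribˡ-+-* q (x′ ℕ.+ i′) z′) ⟩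
  q ^ℚ (x′ ℕ.+ i′) * q ^ℚ z′ * q ^ℚ w′         ≡⟨ cong (λ t → t * q ^ℚ z′ * q ^ℚ w′) (^ℚ-distribˡ-+-* q x′ i′) ⟩
  q ^ℚ x′ * q ^ℚ i′ * q ^ℚ z′ * q ^ℚ w′        ≡⟨ *-assoc (q ^ℚ x′ * q ^ℚ i′) _ _ ⟩
  (q ^ℚ x′ * q ^ℚ i′) * (q ^ℚ z′ * q ^ℚ w′)    ∎
  where
  x′ i′ z′ w′ : ℕ
  x′ = x ∸ 1
  i′ = i ∸ 1
  z′ = z ∸ 1
  w′ = w ∸ 1

sum-blockB-c<d : ∀ q n → sumℚ (map (weight q) (blockB-c<d n))
  ≡ ∑[ i ≤ n ] ∑[ x ≤ i ] ∑< i (λ z w → weight q (x , suc i , z , w))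
sum-blockB-c<d q n = begin
  sumℚ (map (weight q) (blockB-c<d n))
    ≡⟨ sumℚ-map-filterᵇ _ (weight q) (blockB n) ⟩
  _ ≡⟨ sumℚ-map-concatMap _ _ (range1 n) ⟩
  _ ≡⟨ ∑-cong n (λ i → trans (sumℚ-map-concatMap _ _ (range1 i))
       (∑-cong i (λ x → trans (sumℚ-map-concatMap _ _ (range1 i))
         (∑-cong i (λ z → cong sumℚ (sym (map-∘ (range1 i)))))))) ⟩
  ∑[ i ≤ n ] ∑[ x ≤ i ] ∑< i (λ z w → weight q (x , suc i , z , w)) ∎

sum-layer : ∀ q i → ∑[ x ≤ i ] ∑< i (λ z w → weight q (x , suc i , z , w)) ≡ [ i ]⟨ q ⟩ * q ^ℚ (i ∸ 1) * e₂ q i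
sum-layer q i = begin
  ∑[ x ≤ i ] ∑< i (λ z w → weight q (x , suc i , z , w))
    ≡⟨ ∑-cong i (λ x → ∑<-cong i (weight-split q i x)) ⟩
  ∑[ x ≤ i ] ∑< i (λ z w → (q ^ℚ (x ∸ 1) * q ^ℚ (i ∸ 1)) * (q ^ℚ (z ∸ 1) * q ^ℚ (w ∸ 1)))
    ≡⟨ ∑-cong i (λ x → sym (*-distribˡ-∑< i (q ^ℚ (x ∸ 1) * q ^ℚ (i ∸ 1)) _)) ⟩
  ∑[ x ≤ i ] (q ^ℚ (x ∸ 1) * q ^ℚ (i ∸ 1) * e₂ q i)
    ≡⟨ sym (*-distribʳ-sumℚ-map (e₂ q i) _ (range1 i)) ⟩
  (∑[ x ≤ i ] (q ^ℚ (x ∸ 1) * q ^ℚ (i ∸ 1))) * e₂ q i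
    ≡⟨ cong (_* e₂ q i) (sym (*-distribʳ-sumℚ-map (q ^ℚ (i ∸ 1)) _ (range1 i))) ⟩
  (∑[ x ≤ i ] q ^ℚ (x ∸ 1)) * q ^ℚ (i ∸ 1) * e₂ q i
    ≡⟨ cong (λ t → t * q ^ℚ (i ∸ 1) * e₂ q i) (geometric-sum q i) ⟩
  [ i ]⟨ q ⟩ * q ^ℚ (i ∸ 1) * e₂ q i ∎

1/p*[x*[p*y]]≡x*y : ∀ p .{{_ : NonZero p}} x y → 1/ p * (x * (p * y)) ≡ x * y
1/p*[x*[p*y]]≡x*y p x y = begin
  1/ p * (x * (p * y))    ≡⟨ solve 4 (λ u p x y → u :* (x :* (p :* y)) := (u :* p) :* (x :* y)) refl (1/ p) p x y ⟩
  (1/ p * p) * (x * y)    ≡⟨ cong (_* (x * y)) (*-inverseˡ p) ⟩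
  1ℚ * (x * y)            ≡⟨ *-identityˡ (x * y) ⟩
  x * y                   ∎

lemma18 : (n : ℕ) → 2 ≤ n → (q : ℚ) → .{{_ : NonZero q}} → .{{_ : NonZero (1ℚ + q)}} →
    sumℚ (map (λ k → [ k ]⟨ q ⟩ * (q ^ℚ (k ∸ 1)) * (([ k ]⟨ q ⟩ * [ k ∸ 1 ]⟨ q ⟩) ÷ (1ℚ + q))) (range1 n))
      ≡ (1/ q) * sumℚ (map (weight q) (blockB-c<d n))
-- The identity holds for every n.
lemma18 n _ q = sym (begin
  1/ q * sumℚ (map (weight q) (blockB-c<d n))
    ≡⟨ cong (1/ q *_) (sum-blockB-c<d q n) ⟩
  1/ q * ∑[ i ≤ n ] ∑[ x ≤ i ] ∑< i (λ z w → weight q (x , suc i , z , w))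
    ≡⟨ *-distribˡ-sumℚ-map (1/ q) _ (range1 n) ⟩
  ∑[ i ≤ n ] (1/ q * ∑[ x ≤ i ] ∑< i (λ z w → weight q (x , suc i , z , w)))
    ≡⟨ ∑-cong n (λ i → cong (1/ q *_) (sum-layer q i)) ⟩
  ∑[ i ≤ n ] (1/ q * (c i * e₂ q i))
    ≡⟨ ∑-cong n (λ i → cong (λ t → 1/ q * (c i * t)) (e₂≡q*[n]*[n-1]÷[1+q] q i)) ⟩
  ∑[ i ≤ n ] (1/ q * (c i * (q * r i)))
    ≡⟨ ∑-cong n (λ i → 1/p*[x*[p*y]]≡x*y q (c i) (r i)) ⟩
  ∑[ i ≤ n ] (c i * r i) ∎)
  where
  c r : ℕ → ℚ
  c i = [ i ]⟨ q ⟩ * q ^ℚ (i ∸ 1)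
  r i = [ i ]⟨ q ⟩ * [ i ∸ 1 ]⟨ q ⟩ ÷ (1ℚ + q)
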